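{- For every nonnegative integer $n$, the number of even-zeroed balanced $2n$-paths (i.e. even-zeroed paths of length $4n$ consisting of $2n$ up-steps and $2n$ down-steps) equals $C_{2n}$.
   Context: A path of length $l$ is a sequence of $l$ steps, each an up-step $(1,1)$ or a down-step $(1,-1)$, drawn in the plane starting at the origin. A balanced $m$-path is a path of length $2m$ with exactly $m$ up-steps and $m$ down-steps. The $x$-intercepts of a path are the $x$-coordinates $k\in\{0,1,\dots,l\}$ of the lattice points $(k,0)$ visited by the path (i.e. those $k$ for which the first $k$ steps contain equally many up- and down-steps; this includes $k=0$). A path is called even-zeroed if all of its $x$-intercepts are divisible by $4$. $C_m=\frac{1}{m+1}\binom{2m}{m}$ denotes the $m$th Catalan number. -}

module Defs where

open import Data.Nat using (ℕ; zero; suc; _+_; _*_; _≤_; s≤s)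
open import Data.Nat.Divisibility using (_∣_)
open import Data.Nat.DivMod using (_/_)
open import Data.Nat.Combinatorics using (_C_)
open import Data.Integer as ℤ using (ℤ)
open import Data.Vec using (Vec; []; _∷_; count)
open import Data.List using (List; length)
open import Data.List.Membership.Propositional using (_∈_)
open import Data.List.Relation.Unary.Unique.Propositional using (Unique)
open import Data.Product using (_×_; Σ)
open import Function.Bundles using (_⇔_)
open import Relation.Binary.PropositionalEquality using (_≡_)
open import Relation.Nullary using (Dec; yes; no)

data Step : Set where
  up down : Step

Path : ℕ → Set
Path l = Vec Step l

height : ∀ {k} → Vec Step k → ℤ
height [] = ℤ.0ℤ
height (up ∷ s) = ℤ.1ℤ ℤ.+ height s
height (down ∷ s) = ℤ.-1ℤ ℤ.+ height s

isUp : (s : Step) → Dec (s ≡ up)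
isUp up = yes _≡_.refl
isUp down = no (λ ())

ups : ∀ {l} → Path l → ℕ
ups p = count isUp p

Balanced : (m : ℕ) → Path (2 * m) → Set
Balanced m p = ups p ≡ m

prefix : ∀ {A : Set} {n} (k : ℕ) → Vec A n → k ≤ n → Vec A k
prefix zero _ _ = []
prefix (suc k) (x ∷ xs) (s≤s h) = x ∷ prefix k xs h

XIntercept : ∀ {l} → Path l → (k : ℕ) → k ≤ l → Set
XIntercept p k k≤l = height (prefix k p k≤l) ≡ ℤ.0ℤ

EvenZeroed : ∀ {l} → Path l → Set
EvenZeroed {l} p = (k : ℕ) (k≤l : k ≤ l) → XIntercept p k k≤l → 4 ∣ k

Catalan : ℕ → ℕ
Catalan m = ((2 * m) C m) / suc m

HasCount : {A : Set} → (A → Set) → ℕ → Set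
HasCount {A} P c =
  Σ (List A) (λ xs → Unique xs × ((a : A) → (a ∈ xs) ⇔ P a) × length xs ≡ c)

module Submission where

-- Track a path by its height and its position modulo 4. Let F t be the number of paths of length t
-- from height 1 that first reach 0 at the end, and E L the number of even-zeroed paths of length L
-- (4 ∣ L) ending at 0. Splitting at the first return to 0 gives
--   E L = 2 Σ_t F t · [4 ∣ t + 1] · E (L − 1 − t),
-- and by induction E L = F (L + 1): F t vanishes for even t, and for odd t exactly one of t + 1 and
-- L − t + 1 is divisible by 4, so the sum is Σ_t F t · F (L − t) = F (L + 1).
-- Finally F (2m + 1) = C_m by the reflection principle.

open import Data.Nat using (ℕ; zero; suc; _+_; _*_; _∸_; _≤_; _<_; z≤n; s≤s)
open import Data.Nat.Properties
open import Data.Nat.Combinatorics using (_C_; nCk+nC[k+1]≡[n+1]C[k+1]; nCk≡nC[n∸k]; nCn≡1)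
open import Data.Nat.DivMod using (_/_; m*n/n≡m)
open import Data.Nat.Divisibility using (_∣_; divides; _∣0; ∣m∣n⇒∣m+n; ∣-refl)
open import Data.Nat.Induction using (<-rec)
open import Data.Nat.Tactic.RingSolver using (solve-∀)
open import Data.Bool using (Bool; true; false; not; _∧_; if_then_else_)
open import Data.Bool.Properties using (not-involutive) renaming (_≟_ to _≟ᵇ_)
open import Data.List using (List; []; _∷_; map; _++_; filter; length)
open import Data.List.Properties using (length-++; filter-++)
open import Data.List.Membership.Propositional using (_∈_)
open import Data.List.Membership.Propositional.Properties using (∈-map⁺; ∈-map⁻; ∈-++⁺ˡ; ∈-++⁺ʳ; ∈-filter⁺; ∈-filter⁻)
open import Data.List.Relation.Unary.Any using (here)
open import Data.List.Relation.Unary.All as All using ()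
open import Data.List.Relation.Unary.AllPairs as AllPairs using ()
open import Data.List.Relation.Unary.Unique.Propositional using (Unique)
import Data.List.Relation.Unary.Unique.Propositional.Properties as Unique
open import Data.Empty using (⊥; ⊥-elim)
open import Data.Integer as ℤ using (ℤ; +0; +[1+_]; -[1+_]; 0ℤ; _⊖_)
import Data.Integer.Properties as ℤ
open import Data.Product using (_×_; _,_; proj₂)
open import Data.Vec using (Vec; []; _∷_)
open import Function.Bundles using (_⇔_; mk⇔; Equivalence)
open import Relation.Binary.PropositionalEquality

open import Defs

Σ< : ℕ → (ℕ → ℕ) → ℕ
Σ< zero    f = 0
Σ< (suc n) f = f 0 + Σ< n (λ t → f (suc t))

Σ<-cong : ∀ n {f g : ℕ → ℕ} → (∀ t → t < n → f t ≡ g t) → Σ< n f ≡ Σ< n g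
Σ<-cong zero    f≡g = refl
Σ<-cong (suc n) f≡g = cong₂ _+_ (f≡g 0 (s≤s z≤n)) (Σ<-cong n (λ t t<n → f≡g (suc t) (s≤s t<n)))

Σ<-distrib-+ : ∀ n (f g : ℕ → ℕ) → Σ< n (λ t → f t + g t) ≡ Σ< n f + Σ< n g
Σ<-distrib-+ zero    f g = refl
Σ<-distrib-+ (suc n) f g =
  trans (cong (f 0 + g 0 +_) (Σ<-distrib-+ n (λ t → f (suc t)) (λ t → g (suc t))))
        (+-assoc-swap (f 0) (g 0) _ _)
  where
  +-assoc-swap : ∀ a b c d → a + b + (c + d) ≡ a + c + (b + d)
  +-assoc-swap = solve-∀

Σ<-zero : ∀ n → Σ< n (λ _ → 0) ≡ 0
Σ<-zero zero    = refl
Σ<-zero (suc n) = Σ<-zero n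

Σ<-snoc : ∀ n (f : ℕ → ℕ) → Σ< (suc n) f ≡ Σ< n f + f n
Σ<-snoc zero    f = +-comm (f 0) 0
Σ<-snoc (suc n) f = trans (cong (f 0 +_) (Σ<-snoc n (λ t → f (suc t)))) (sym (+-assoc (f 0) _ _))

Σ<-reverse : ∀ n (f : ℕ → ℕ) → Σ< (suc n) f ≡ Σ< (suc n) (λ t → f (n ∸ t))
Σ<-reverse zero    f = refl
Σ<-reverse (suc n) f = begin
  f 0 + Σ< (suc n) (λ t → f (suc t))                ≡⟨ cong (f 0 +_) (Σ<-reverse n (λ t → f (suc t))) ⟩
  f 0 + Σ< (suc n) (λ t → f (suc (n ∸ t)))          ≡⟨ cong (f 0 +_) (Σ<-cong (suc n) (λ t t<1+n →
                                                          cong f (sym (+-∸-assoc 1 (≤-pred t<1+n))))) ⟩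
  f 0 + Σ< (suc n) (λ t → f (suc n ∸ t))            ≡⟨ +-comm (f 0) _ ⟩
  Σ< (suc n) (λ t → f (suc n ∸ t)) + f 0            ≡⟨ cong (λ k → Σ< (suc n) (λ t → f (suc n ∸ t)) + f k) (n∸n≡0 (suc n)) ⟨
  Σ< (suc n) (λ t → f (suc n ∸ t)) + f (suc n ∸ suc n) ≡⟨ Σ<-snoc (suc n) (λ t → f (suc n ∸ t)) ⟨
  Σ< (suc (suc n)) (λ t → f (suc n ∸ t))            ∎
  where open ≡-Reasoning

-- firstPassage L h counts the paths of length L from height h that reach height 0 for the
-- first time at their last step.
firstPassage : ℕ → ℕ → ℕ
firstPassage zero    zero    = 1
firstPassage zero    (suc h) = 0
firstPassage (suc L) zero    = 0
firstPassage (suc L) (suc h) = firstPassage L (suc (suc h)) + firstPassage L h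

-- To descend from h + 1 to 0, first descend to h (after t steps), then by one more level.
firstPassage-split : ∀ L h →
  firstPassage L (suc h) ≡ Σ< (suc L) (λ t → firstPassage t h * firstPassage (L ∸ t) 1)
firstPassage-split zero    zero    = refl
firstPassage-split zero    (suc h) = refl
firstPassage-split (suc L) zero    = begin
  firstPassage (suc L) 1                                  ≡⟨ +-identityʳ _ ⟨
  firstPassage (suc L) 1 + 0                              ≡⟨ cong (firstPassage (suc L) 1 +_) (Σ<-zero (suc L)) ⟨
  firstPassage (suc L) 1 + Σ< (suc L) (λ _ → 0)           ≡⟨ cong (_+ Σ< (suc L) (λ _ → 0)) (+-identityʳ _) ⟨
  Σ< (suc (suc L)) (λ t → firstPassage t 0 * firstPassage (suc L ∸ t) 1) ∎
  where open ≡-Reasoning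
firstPassage-split (suc L) (suc h) = begin
  firstPassage L (3 + h) + firstPassage L (suc h)
    ≡⟨ cong₂ _+_ (firstPassage-split L (2 + h)) (firstPassage-split L h) ⟩
  Σ< (suc L) (λ t → firstPassage t (2 + h) * R t) + Σ< (suc L) (λ t → firstPassage t h * R t)
    ≡⟨ Σ<-distrib-+ (suc L) (λ t → firstPassage t (2 + h) * R t) (λ t → firstPassage t h * R t) ⟨
  Σ< (suc L) (λ t → firstPassage t (2 + h) * R t + firstPassage t h * R t)
    ≡⟨ Σ<-cong (suc L) (λ t _ → *-distribʳ-+ (R t) (firstPassage t (2 + h)) (firstPassage t h)) ⟨
  Σ< (suc (suc L)) (λ t → firstPassage t (suc h) * firstPassage (suc L ∸ t) 1) ∎
  where
  open ≡-Reasoning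
  R : ℕ → ℕ
  R t = firstPassage (L ∸ t) 1

firstPassage-tooShort : ∀ L h → L < h → firstPassage L h ≡ 0
firstPassage-tooShort zero    (suc h) _         = refl
firstPassage-tooShort (suc L) (suc h) (s≤s L<h) =
  cong₂ _+_ (firstPassage-tooShort L (2 + h) (m<n⇒m<1+n (m<n⇒m<1+n L<h))) (firstPassage-tooShort L h L<h)

firstPassage-straight : ∀ n → firstPassage n n ≡ 1
firstPassage-straight zero    = refl
firstPassage-straight (suc n) =
  trans (cong (_+ firstPassage n n) (firstPassage-tooShort n (2 + n) (m<n⇒m<1+n (n<1+n n))))
        (firstPassage-straight n)

binomial : ℕ → ℕ → ℕ
binomial n       zero    = 1
binomial zero    (suc k) = 0
binomial (suc n) (suc k) = binomial n k + binomial n (suc k)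

binomial≡C : ∀ n k → binomial n k ≡ n C k
binomial≡C n       zero    = sym (trans (nCk≡nC[n∸k] {0} {n} z≤n) (nCn≡1 n))
binomial≡C zero    (suc k) = refl
binomial≡C (suc n) (suc k) =
  trans (cong₂ _+_ (binomial≡C n k) (binomial≡C n (suc k))) (nCk+nC[k+1]≡[n+1]C[k+1] n k)

binomial-tooBig : ∀ n k → n < k → binomial n k ≡ 0
binomial-tooBig zero    (suc k) _         = refl
binomial-tooBig (suc n) (suc k) (s≤s n<k) =
  cong₂ _+_ (binomial-tooBig n k n<k) (binomial-tooBig n (suc k) (m<n⇒m<1+n n<k))

-- The reflection principle, in subtraction-free form.
ballot : ∀ d h L → L ≡ h + (d + d) →
  firstPassage (suc L) (suc h) + binomial L (suc (h + d)) ≡ binomial L d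
ballot zero h L refl rewrite +-identityʳ h | binomial-tooBig h (suc h) (n<1+n h) =
  trans (+-identityʳ _) (firstPassage-straight (suc h))
ballot (suc e) h zero eq with () ← trans eq (+-suc h (e + suc e))
ballot (suc e) zero (suc L) eq = begin
  firstPassage (suc L) 2 + 0 + (binomial L (suc e) + binomial L (2 + e))
    ≡⟨ rearrange (firstPassage (suc L) 2) (binomial L (suc e)) (binomial L (2 + e)) ⟩
  firstPassage (suc L) 2 + binomial L (2 + e) + binomial L (suc e)
    ≡⟨ cong (_+ binomial L (suc e)) (ballot e 1 L (trans (suc-injective eq) (+-suc e e))) ⟩
  binomial L e + binomial L (suc e) ∎
  where
  open ≡-Reasoning
  rearrange : ∀ a x y → a + 0 + (x + y) ≡ a + y + x
  rearrange = solve-∀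
ballot (suc e) (suc h) (suc L) eq = begin
  firstPassage (suc L) (3 + h) + firstPassage (suc L) (suc h)
    + (binomial L (suc h + suc e) + binomial L (2 + (h + suc e)))
    ≡⟨ cong (λ k → firstPassage (suc L) (3 + h) + firstPassage (suc L) (suc h)
                     + (binomial L (suc h + suc e) + binomial L (suc k))) (+-suc (suc h) e) ⟩
  firstPassage (suc L) (3 + h) + firstPassage (suc L) (suc h)
    + (binomial L (suc h + suc e) + binomial L (3 + (h + e)))
    ≡⟨ rearrange (firstPassage (suc L) (3 + h)) (firstPassage (suc L) (suc h))
                 (binomial L (suc h + suc e)) (binomial L (3 + (h + e))) ⟩
  (firstPassage (suc L) (3 + h) + binomial L (3 + (h + e)))
    + (firstPassage (suc L) (suc h) + binomial L (suc h + suc e))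
    ≡⟨ cong₂ _+_ (ballot e (2 + h) L (trans (suc-injective eq) (shift h e)))
                 (ballot (suc e) h L (suc-injective eq)) ⟩
  binomial L e + binomial L (suc e) ∎
  where
  open ≡-Reasoning
  rearrange : ∀ a b x y → a + b + (x + y) ≡ (a + y) + (b + x)
  rearrange = solve-∀
  shift : ∀ h e → h + suc (e + suc e) ≡ 2 + h + (e + e)
  shift = solve-∀

binomial-absorption : ∀ n k → suc k * binomial n (suc k) + k * binomial n k ≡ n * binomial n k
binomial-absorption zero    zero    = refl
binomial-absorption zero    (suc k) = cong₂ _+_ (*-zeroʳ (2 + k)) (*-zeroʳ (suc k))
binomial-absorption (suc n) zero    = begin
  binomial n 0 + binomial n 1 + 0 + 0       ≡⟨ rearrange (binomial n 1) ⟩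
  1 + (1 * binomial n 1 + 0 * binomial n 0) ≡⟨ cong (1 +_) (binomial-absorption n 0) ⟩
  suc n * 1                                 ∎
  where
  open ≡-Reasoning
  rearrange : ∀ x → (1 + x) + 0 + 0 ≡ 1 + (1 * x + 0 * 1)
  rearrange = solve-∀
binomial-absorption (suc n) (suc j) = begin
  (2 + j) * (a + b) + (1 + j) * (c + a)              ≡⟨ rearrange j a b c ⟩
  ((2 + j) * b + (1 + j) * a) + a + ((1 + j) * a + j * c) + c
    ≡⟨ cong₂ (λ x y → x + a + y + c) (binomial-absorption n (suc j)) (binomial-absorption n j) ⟩
  n * a + a + n * c + c                              ≡⟨ collect n a c ⟩
  (1 + n) * (c + a)                                  ∎
  where
  open ≡-Reasoning
  a = binomial n (suc j)
  b = binomial n (2 + j)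
  c = binomial n j
  rearrange : ∀ j a b c →
    (2 + j) * (a + b) + (1 + j) * (c + a) ≡ ((2 + j) * b + (1 + j) * a) + a + ((1 + j) * a + j * c) + c
  rearrange = solve-∀
  collect : ∀ n a c → n * a + a + n * c + c ≡ (1 + n) * (c + a)
  collect = solve-∀

firstPassage*suc≡centralBinomial : ∀ m → firstPassage (suc (2 * m)) 1 * suc m ≡ binomial (2 * m) m
firstPassage*suc≡centralBinomial m = +-cancelʳ-≡ _ _ _ (begin
  q * suc m + suc m * Y ≡⟨ factor q Y m ⟩
  (q + Y) * suc m       ≡⟨ cong (_* suc m) (ballot m 0 (2 * m) (cong (m +_) (+-identityʳ m))) ⟩
  X * suc m             ≡⟨ *-comm X (suc m) ⟩
  X + m * X             ≡⟨ cong (X +_) absorption ⟨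
  X + suc m * Y         ∎)
  where
  open ≡-Reasoning
  q = firstPassage (suc (2 * m)) 1
  X = binomial (2 * m) m
  Y = binomial (2 * m) (suc m)
  factor : ∀ q Y m → q * suc m + suc m * Y ≡ (q + Y) * suc m
  factor = solve-∀
  double : ∀ m X → (2 * m) * X ≡ m * X + m * X
  double = solve-∀
  absorption : suc m * Y ≡ m * X
  absorption = +-cancelʳ-≡ _ _ _ (trans (binomial-absorption (2 * m) m) (double m X))

catalan≡firstPassage : ∀ m → Catalan m ≡ firstPassage (suc (2 * m)) 1
catalan≡firstPassage m = begin
  ((2 * m) C m) / suc m                          ≡⟨ cong (_/ suc m) (binomial≡C (2 * m) m) ⟨
  binomial (2 * m) m / suc m                     ≡⟨ cong (_/ suc m) (firstPassage*suc≡centralBinomial m) ⟨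
  (firstPassage (suc (2 * m)) 1 * suc m) / suc m ≡⟨ m*n/n≡m (firstPassage (suc (2 * m)) 1) (suc m) ⟩
  firstPassage (suc (2 * m)) 1                   ∎
  where open ≡-Reasoning

-- Positions modulo 4.
data Phase : Set where
  ph0 ph1 ph2 ph3 : Phase

next : Phase → Phase
next ph0 = ph1
next ph1 = ph2
next ph2 = ph3
next ph3 = ph0

negate : Phase → Phase
negate ph0 = ph0
negate ph1 = ph3
negate ph2 = ph2
negate ph3 = ph1

advance : Phase → ℕ → Phase
advance r zero    = r
advance r (suc t) = advance (next r) t

phase : ℕ → Phase
phase = advance ph0

isPh0 : Phase → Bool
isPh0 ph0 = true
isPh0 _   = false

isEven : Phase → Bool
isEven ph0 = true
isEven ph1 = false
isEven ph2 = true
isEven ph3 = false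

advance-next : ∀ r t → advance (next r) t ≡ next (advance r t)
advance-next r zero    = refl
advance-next r (suc t) = advance-next (next r) t

advance-+ : ∀ r a b → advance r (a + b) ≡ advance (advance r a) b
advance-+ r zero    b = refl
advance-+ r (suc a) b = advance-+ (next r) a b

phase-suc : ∀ t → phase (suc t) ≡ next (phase t)
phase-suc = advance-next ph0

advance≡ph0⇒phase≡negate : ∀ r u → advance r u ≡ ph0 → phase u ≡ negate r
advance≡ph0⇒phase≡negate .ph0 zero refl = refl
advance≡ph0⇒phase≡negate r (suc u) eq = begin
  phase (suc u)           ≡⟨ phase-suc u ⟩
  next (phase u)          ≡⟨ cong next (advance≡ph0⇒phase≡negate (next r) u eq) ⟩
  next (negate (next r))  ≡⟨ next-negate-next r ⟩
  negate r                ∎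
  where
  open ≡-Reasoning
  next-negate-next : ∀ r → next (negate (next r)) ≡ negate r
  next-negate-next ph0 = refl
  next-negate-next ph1 = refl
  next-negate-next ph2 = refl
  next-negate-next ph3 = refl

isEven-next : ∀ r → isEven (next r) ≡ not (isEven r)
isEven-next ph0 = refl
isEven-next ph1 = refl
isEven-next ph2 = refl
isEven-next ph3 = refl

isEven-phase-suc : ∀ t → isEven (phase (suc t)) ≡ not (isEven (phase t))
isEven-phase-suc t = trans (cong isEven (phase-suc t)) (isEven-next (phase t))

phase≡ph0⇒4∣ : ∀ k → phase k ≡ ph0 → 4 ∣ k
phase≡ph0⇒4∣ zero                      _  = 4 ∣0
phase≡ph0⇒4∣ (suc (suc (suc (suc k)))) eq = ∣m∣n⇒∣m+n {4} {4} {k} ∣-refl (phase≡ph0⇒4∣ k eq)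

phase-*4 : ∀ q → phase (q * 4) ≡ ph0
phase-*4 zero    = refl
phase-*4 (suc q) = phase-*4 q

4∣⇒phase≡ph0 : ∀ k → 4 ∣ k → phase k ≡ ph0
4∣⇒phase≡ph0 k (divides q refl) = phase-*4 q

firstPassage-parity : ∀ L h → isEven (phase L) ≢ isEven (phase h) → firstPassage L h ≡ 0
firstPassage-parity zero    zero    differ = ⊥-elim (differ refl)
firstPassage-parity zero    (suc h) differ = refl
firstPassage-parity (suc L) zero    differ = refl
firstPassage-parity (suc L) (suc h) differ =
  cong₂ _+_ (firstPassage-parity L (2 + h) (λ eq → differ′ (trans eq (isEven-phase-suc-suc h))))
            (firstPassage-parity L h differ′)
  where
  differ′ : isEven (phase L) ≢ isEven (phase h)
  differ′ eq = differ (trans (isEven-phase-suc L) (trans (cong not eq) (sym (isEven-phase-suc h))))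
  isEven-phase-suc-suc : ∀ h → isEven (phase (2 + h)) ≡ isEven (phase h)
  isEven-phase-suc-suc h =
    trans (isEven-phase-suc (suc h)) (trans (cong not (isEven-phase-suc h)) (not-involutive _))

firstPassage-even : ∀ t → isEven (phase t) ≡ true → firstPassage t 1 ≡ 0
firstPassage-even t even = firstPassage-parity t 1 (λ eq → true≢false (trans (sym even) eq))
  where
  true≢false : true ≢ false
  true≢false ()

-- Of two odd numbers t, u with 4 ∣ t + u, exactly one has its successor divisible by 4.
oddPair : ∀ c qt qu → (isEven c ≡ true → qt ≡ 0) → (isEven (negate c) ≡ true → qu ≡ 0) →
  qt * qu ≡ qt * (if isPh0 (next c) then qu else 0) + qu * (if isPh0 (next (negate c)) then qt else 0)
oddPair ph0 qt qu qt≡0 qu≡0 rewrite qt≡0 refl | qu≡0 refl = refl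
oddPair ph1 qt qu _ _ rewrite *-zeroʳ qt = *-comm qt qu
oddPair ph2 qt qu qt≡0 qu≡0 rewrite qt≡0 refl | qu≡0 refl = refl
oddPair ph3 qt qu _ _ rewrite *-zeroʳ qu = sym (+-identityʳ (qt * qu))

δ : Step → ℤ
δ up   = ℤ.1ℤ
δ down = ℤ.-1ℤ

shift-height : ∀ {k} z x (q : Vec Step k) → z ℤ.+ height (x ∷ q) ≡ (δ x ℤ.+ z) ℤ.+ height q
shift-height z x q = begin
  z ℤ.+ height (x ∷ q)           ≡⟨ cong (ℤ._+_ z) (height-∷ x) ⟩
  z ℤ.+ (δ x ℤ.+ height q)       ≡⟨ ℤ.+-assoc z (δ x) (height q) ⟨
  (z ℤ.+ δ x) ℤ.+ height q       ≡⟨ cong (λ w → w ℤ.+ height q) (ℤ.+-comm z (δ x)) ⟩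
  (δ x ℤ.+ z) ℤ.+ height q       ∎
  where
  open ≡-Reasoning
  height-∷ : ∀ x → height (x ∷ q) ≡ δ x ℤ.+ height q
  height-∷ up   = refl
  height-∷ down = refl

isZero : ℤ → Bool
isZero +0 = true
isZero _  = false

allowed : ℤ → Phase → Bool
allowed +0 r = isPh0 r
allowed _  r = true

accepts : ∀ {L} → ℤ → Phase → Vec Step L → Bool
accepts z r []      = isZero z
accepts z r (x ∷ p) = allowed (δ x ℤ.+ z) (next r) ∧ accepts (δ x ℤ.+ z) (next r) p

EndsAtZero : ∀ {L} → ℤ → Vec Step L → Set
EndsAtZero z p = z ℤ.+ height p ≡ 0ℤ

ZeroesOnPhase0 : ∀ {L} → ℤ → Phase → Vec Step L → Set
ZeroesOnPhase0 {L} z r p =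
  ∀ k (k<L : suc k ≤ L) → EndsAtZero z (prefix (suc k) p k<L) → advance r (suc k) ≡ ph0

allowed-sound : ∀ z r → allowed z r ≡ true → z ≡ 0ℤ → r ≡ ph0
allowed-sound +0 ph0 _ _ = refl

allowed-complete : ∀ z r → (z ≡ 0ℤ → r ≡ ph0) → allowed z r ≡ true
allowed-complete +0       r onZero rewrite onZero refl = refl
allowed-complete +[1+ n ] r onZero = refl
allowed-complete -[1+ n ] r onZero = refl

accepts-sound : ∀ {L} z r (p : Vec Step L) → accepts z r p ≡ true → EndsAtZero z p × ZeroesOnPhase0 z r p
accepts-sound +0 r []      _  = refl , λ k ()
accepts-sound z  r (x ∷ q) ok with allowed (δ x ℤ.+ z) (next r) in allowedEq | ok
... | true | okq with accepts-sound (δ x ℤ.+ z) (next r) q okq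
...   | ends , zeroes = trans (shift-height z x q) ends , zeroes′
  where
  zeroes′ : ZeroesOnPhase0 z r (x ∷ q)
  zeroes′ zero    (s≤s _)   atZero = allowed-sound (δ x ℤ.+ z) (next r) allowedEq
    (trans (sym (ℤ.+-identityʳ _)) (trans (sym (shift-height z x [])) atZero))
  zeroes′ (suc k) (s≤s k<L) atZero =
    zeroes k k<L (trans (sym (shift-height z x (prefix (suc k) q k<L))) atZero)

accepts-complete : ∀ {L} z r (p : Vec Step L) → EndsAtZero z p → ZeroesOnPhase0 z r p → accepts z r p ≡ true
accepts-complete +0 r []      _    _      = refl
accepts-complete z  r (x ∷ q) ends zeroes = cong₂ _∧_
  (allowed-complete (δ x ℤ.+ z) (next r) λ atZero →
    zeroes zero (s≤s z≤n) (trans (shift-height z x []) (trans (ℤ.+-identityʳ _) atZero)))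
  (accepts-complete (δ x ℤ.+ z) (next r) q (trans (sym (shift-height z x q)) ends)
    λ k k<L atZero → zeroes (suc k) (s≤s k<L) (trans (shift-height z x (prefix (suc k) q k<L)) atZero))

count : (L : ℕ) → (Vec Step L → Bool) → ℕ
count zero    f = if f [] then 1 else 0
count (suc L) f = count L (λ p → f (up ∷ p)) + count L (λ p → f (down ∷ p))

count-false : ∀ L → count L (λ _ → false) ≡ 0
count-false zero    = refl
count-false (suc L) = cong₂ _+_ (count-false L) (count-false L)

count-∧ : ∀ L b (f : Vec Step L → Bool) → count L (λ p → b ∧ f p) ≡ (if b then count L f else 0)
count-∧ L true  f = refl
count-∧ L false f = count-false L

completions : ℕ → ℤ → Phase → ℕ
completions L z r = count L (accepts z r)

completions-suc : ∀ L z r → completions (suc L) z r ≡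
  (if allowed (ℤ.1ℤ ℤ.+ z) (next r) then completions L (ℤ.1ℤ ℤ.+ z) (next r) else 0) +
  (if allowed (ℤ.-1ℤ ℤ.+ z) (next r) then completions L (ℤ.-1ℤ ℤ.+ z) (next r) else 0)
completions-suc L z r = cong₂ _+_ (count-∧ L _ (accepts (ℤ.1ℤ ℤ.+ z) (next r)))
                                  (count-∧ L _ (accepts (ℤ.-1ℤ ℤ.+ z) (next r)))

restart : ℕ → Phase → ℕ
restart L r = if isPh0 r then completions L 0ℤ r else 0

restart-cong : ∀ L r n → (r ≡ ph0 → completions L 0ℤ ph0 ≡ n) → restart L r ≡ (if isPh0 r then n else 0)
restart-cong L ph0 n eq = eq refl
restart-cong L ph1 n eq = refl
restart-cong L ph2 n eq = refl
restart-cong L ph3 n eq = refl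

-- Split a path from height k by the time t at which it first reaches 0.
viaFirstReturn : ℕ → ℕ → Phase → ℕ
viaFirstReturn L k r = Σ< (suc L) (λ t → firstPassage t k * restart (L ∸ t) (advance r t))

viaFirstReturn-zero : ∀ L r → viaFirstReturn L 0 r ≡ restart L r
viaFirstReturn-zero L r =
  trans (cong₂ _+_ (+-identityʳ (restart L r)) (Σ<-zero L)) (+-identityʳ (restart L r))

viaFirstReturn-suc : ∀ L k r →
  viaFirstReturn L (2 + k) (next r) + viaFirstReturn L k (next r) ≡ viaFirstReturn (suc L) (suc k) r
viaFirstReturn-suc L k r = begin
  Σ< (suc L) (λ t → firstPassage t (2 + k) * R t) + Σ< (suc L) (λ t → firstPassage t k * R t)
    ≡⟨ Σ<-distrib-+ (suc L) (λ t → firstPassage t (2 + k) * R t) (λ t → firstPassage t k * R t) ⟨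
  Σ< (suc L) (λ t → firstPassage t (2 + k) * R t + firstPassage t k * R t)
    ≡⟨ Σ<-cong (suc L) (λ t _ → *-distribʳ-+ (R t) (firstPassage t (2 + k)) (firstPassage t k)) ⟨
  viaFirstReturn (suc L) (suc k) r ∎
  where
  open ≡-Reasoning
  R : ℕ → ℕ
  R t = restart (L ∸ t) (advance (next r) t)

completions-pos : ∀ L h r → completions L +[1+ h ] r ≡ viaFirstReturn L (suc h) r
completions-pos zero    h       r = refl
completions-pos (suc L) zero    r = begin
  completions (suc L) +[1+ 0 ] r                             ≡⟨ completions-suc L +[1+ 0 ] r ⟩
  completions L +[1+ 1 ] (next r) + restart L (next r)
    ≡⟨ cong₂ _+_ (completions-pos L 1 (next r)) (sym (viaFirstReturn-zero L (next r))) ⟩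
  viaFirstReturn L 2 (next r) + viaFirstReturn L 0 (next r) ≡⟨ viaFirstReturn-suc L 0 r ⟩
  viaFirstReturn (suc L) 1 r                                 ∎
  where open ≡-Reasoning
completions-pos (suc L) (suc h) r = begin
  completions (suc L) +[1+ suc h ] r                          ≡⟨ completions-suc L +[1+ suc h ] r ⟩
  completions L +[1+ 2 + h ] (next r) + completions L +[1+ h ] (next r)
    ≡⟨ cong₂ _+_ (completions-pos L (2 + h) (next r)) (completions-pos L h (next r)) ⟩
  viaFirstReturn L (3 + h) (next r) + viaFirstReturn L (suc h) (next r) ≡⟨ viaFirstReturn-suc L (suc h) r ⟩
  viaFirstReturn (suc L) (2 + h) r                              ∎
  where open ≡-Reasoning

completions-neg : ∀ L h r → completions L -[1+ h ] r ≡ viaFirstReturn L (suc h) r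
completions-neg zero    h       r = refl
completions-neg (suc L) zero    r = begin
  completions (suc L) -[1+ 0 ] r                             ≡⟨ completions-suc L -[1+ 0 ] r ⟩
  restart L (next r) + completions L -[1+ 1 ] (next r)       ≡⟨ +-comm (restart L (next r)) _ ⟩
  completions L -[1+ 1 ] (next r) + restart L (next r)
    ≡⟨ cong₂ _+_ (completions-neg L 1 (next r)) (sym (viaFirstReturn-zero L (next r))) ⟩
  viaFirstReturn L 2 (next r) + viaFirstReturn L 0 (next r) ≡⟨ viaFirstReturn-suc L 0 r ⟩
  viaFirstReturn (suc L) 1 r                                 ∎
  where open ≡-Reasoning
completions-neg (suc L) (suc h) r = begin
  completions (suc L) -[1+ suc h ] r                          ≡⟨ completions-suc L -[1+ suc h ] r ⟩
  completions L -[1+ h ] (next r) + completions L -[1+ 2 + h ] (next r)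
    ≡⟨ +-comm (completions L -[1+ h ] (next r)) _ ⟩
  completions L -[1+ 2 + h ] (next r) + completions L -[1+ h ] (next r)
    ≡⟨ cong₂ _+_ (completions-neg L (2 + h) (next r)) (completions-neg L h (next r)) ⟩
  viaFirstReturn L (3 + h) (next r) + viaFirstReturn L (suc h) (next r) ≡⟨ viaFirstReturn-suc L (suc h) r ⟩
  viaFirstReturn (suc L) (2 + h) r                              ∎
  where open ≡-Reasoning

phase-∸ : ∀ {a L} → a ≤ L → phase L ≡ ph0 → phase a ≡ ph0 → phase (L ∸ a) ≡ ph0
phase-∸ {a} {L} a≤L phaseL phaseA = begin
  phase (L ∸ a)               ≡⟨ cong (λ r → advance r (L ∸ a)) phaseA ⟨
  advance (phase a) (L ∸ a)   ≡⟨ advance-+ ph0 a (L ∸ a) ⟨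
  phase (a + (L ∸ a))         ≡⟨ cong phase (m+[n∸m]≡n a≤L) ⟩
  phase L                     ≡⟨ phaseL ⟩
  ph0                         ∎
  where open ≡-Reasoning

alignedPairs : ℕ → ℕ → ℕ
alignedPairs L t = firstPassage t 1 * (if isPh0 (phase (suc t)) then firstPassage (L ∸ t) 1 else 0)

pairs≡alignedPairs : ∀ L t → t ≤ L → phase L ≡ ph0 →
  firstPassage t 1 * firstPassage (L ∸ t) 1 ≡ alignedPairs L t + alignedPairs L (L ∸ t)
pairs≡alignedPairs L t t≤L phaseL = begin
  firstPassage t 1 * firstPassage u 1
    ≡⟨ oddPair (phase t) (firstPassage t 1) (firstPassage u 1) (firstPassage-even t)
         (λ even → firstPassage-even u (trans (cong isEven phaseU) even)) ⟩
  firstPassage t 1 * (if isPh0 (next (phase t)) then firstPassage u 1 else 0)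
    + firstPassage u 1 * (if isPh0 (next (negate (phase t))) then firstPassage t 1 else 0)
    ≡⟨ cong₂ (λ a b → firstPassage t 1 * (if isPh0 a then firstPassage u 1 else 0)
                      + firstPassage u 1 * (if isPh0 b then firstPassage t 1 else 0))
             (sym (phase-suc t)) (trans (cong next (sym phaseU)) (sym (phase-suc u))) ⟩
  alignedPairs L t + firstPassage u 1 * (if isPh0 (phase (suc u)) then firstPassage t 1 else 0)
    ≡⟨ cong (λ s → alignedPairs L t + firstPassage u 1 * (if isPh0 (phase (suc u)) then firstPassage s 1 else 0))
            (sym (m∸[m∸n]≡n t≤L)) ⟩
  alignedPairs L t + alignedPairs L u ∎
  where
  open ≡-Reasoning
  u = L ∸ t
  phaseU : phase u ≡ negate (phase t)
  phaseU = advance≡ph0⇒phase≡negate (phase t) u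
    (trans (sym (advance-+ ph0 t u)) (trans (cong phase (m+[n∸m]≡n t≤L)) phaseL))

alignedPairs-last : ∀ L → phase L ≡ ph0 → alignedPairs L L ≡ 0
alignedPairs-last L phaseL = trans
  (cong (λ r → firstPassage L 1 * (if isPh0 r then firstPassage (L ∸ L) 1 else 0))
        (trans (phase-suc L) (cong next phaseL)))
  (*-zeroʳ (firstPassage L 1))

completions-fromZero : ∀ L → phase L ≡ ph0 → completions L 0ℤ ph0 ≡ firstPassage (suc L) 1
completions-fromZero = <-rec (λ L → phase L ≡ ph0 → completions L 0ℤ ph0 ≡ firstPassage (suc L) 1) step
  where
  step : ∀ L → (∀ {m} → m < L → phase m ≡ ph0 → completions m 0ℤ ph0 ≡ firstPassage (suc m) 1) →
         phase L ≡ ph0 → completions L 0ℤ ph0 ≡ firstPassage (suc L) 1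
  step zero     _  _      = refl
  step L@(suc K) ih phaseL = begin
    completions L 0ℤ ph0
      ≡⟨ cong₂ _+_ (completions-pos K 0 ph1) (completions-neg K 0 ph1) ⟩
    viaFirstReturn K 1 ph1 + viaFirstReturn K 1 ph1
      ≡⟨ cong (λ x → x + x) (trans restarted extended) ⟩
    Σ< (suc L) (alignedPairs L) + Σ< (suc L) (alignedPairs L)
      ≡⟨ cong (Σ< (suc L) (alignedPairs L) +_) (Σ<-reverse L (alignedPairs L)) ⟩
    Σ< (suc L) (alignedPairs L) + Σ< (suc L) (λ t → alignedPairs L (L ∸ t))
      ≡⟨ Σ<-distrib-+ (suc L) (alignedPairs L) (λ t → alignedPairs L (L ∸ t)) ⟨
    Σ< (suc L) (λ t → alignedPairs L t + alignedPairs L (L ∸ t))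
      ≡⟨ Σ<-cong (suc L) (λ t t≤L → pairs≡alignedPairs L t (≤-pred t≤L) phaseL) ⟨
    Σ< (suc L) (λ t → firstPassage t 1 * firstPassage (L ∸ t) 1)
      ≡⟨ firstPassage-split L 1 ⟨
    firstPassage L 2
      ≡⟨ +-identityʳ _ ⟨
    firstPassage (suc L) 1 ∎
    where
    open ≡-Reasoning
    restarted : viaFirstReturn K 1 ph1 ≡ Σ< L (alignedPairs L)
    restarted = Σ<-cong L λ t t<L →
      cong (firstPassage t 1 *_) (restart-cong (K ∸ t) (phase (suc t)) (firstPassage (L ∸ t) 1) λ phaseT →
        trans (ih (s≤s (m∸n≤m K t)) (phase-∸ t<L phaseL phaseT))
              (cong (λ n → firstPassage n 1) (sym (+-∸-assoc 1 (≤-pred t<L)))))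
    extended : Σ< L (alignedPairs L) ≡ Σ< (suc L) (alignedPairs L)
    extended = sym (trans (Σ<-snoc L (alignedPairs L))
      (trans (cong (Σ< L (alignedPairs L) +_) (alignedPairs-last L phaseL)) (+-identityʳ _)))

allPaths : ∀ L → List (Path L)
allPaths zero    = [] ∷ []
allPaths (suc L) = map (up ∷_) (allPaths L) ++ map (down ∷_) (allPaths L)

∈-allPaths : ∀ {L} (p : Path L) → p ∈ allPaths L
∈-allPaths []         = here refl
∈-allPaths (up ∷ p)   = ∈-++⁺ˡ (∈-map⁺ (up ∷_) (∈-allPaths p))
∈-allPaths (down ∷ p) = ∈-++⁺ʳ (map (up ∷_) (allPaths _)) (∈-map⁺ (down ∷_) (∈-allPaths p))

allPaths-unique : ∀ L → Unique (allPaths L)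
allPaths-unique zero    = All.[] AllPairs.∷ AllPairs.[]
allPaths-unique (suc L) =
  Unique.++⁺ (Unique.map⁺ ∷-injectiveʳ (allPaths-unique L)) (Unique.map⁺ ∷-injectiveʳ (allPaths-unique L)) disjoint
  where
  ∷-injectiveʳ : ∀ {x} {p q : Path L} → x ∷ p ≡ x ∷ q → p ≡ q
  ∷-injectiveʳ refl = refl
  disjoint : ∀ {p} → p ∈ map (up ∷_) (allPaths L) × p ∈ map (down ∷_) (allPaths L) → ⊥
  disjoint (p∈ups , p∈downs) with ∈-map⁻ (up ∷_) p∈ups | ∈-map⁻ (down ∷_) p∈downs
  ... | _ , _ , refl | _ , _ , ()

module _ {A : Set} (f : A → Bool) where

  accepted : List A → List A
  accepted = filter (λ a → f a ≟ᵇ true)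

  length-accepted-++ : ∀ xs ys → length (accepted (xs ++ ys)) ≡ length (accepted xs) + length (accepted ys)
  length-accepted-++ xs ys = trans (cong length (filter-++ _ xs ys)) (length-++ (accepted xs))

length-accepted-map : ∀ {A B : Set} (f : B → Bool) (g : A → B) xs →
  length (accepted f (map g xs)) ≡ length (accepted (λ a → f (g a)) xs)
length-accepted-map f g []       = refl
length-accepted-map f g (x ∷ xs) with f (g x)
... | true  = cong suc (length-accepted-map f g xs)
... | false = length-accepted-map f g xs

length-accepted-allPaths : ∀ L (f : Path L → Bool) → length (accepted f (allPaths L)) ≡ count L f
length-accepted-allPaths zero    f with f []
... | true  = refl
... | false = refl
length-accepted-allPaths (suc L) f = begin
  length (accepted f (map (up ∷_) (allPaths L) ++ map (down ∷_) (allPaths L)))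
    ≡⟨ length-accepted-++ f (map (up ∷_) (allPaths L)) (map (down ∷_) (allPaths L)) ⟩
  length (accepted f (map (up ∷_) (allPaths L))) + length (accepted f (map (down ∷_) (allPaths L)))
    ≡⟨ cong₂ _+_ (length-accepted-map f (up ∷_) (allPaths L)) (length-accepted-map f (down ∷_) (allPaths L)) ⟩
  length (accepted (λ p → f (up ∷ p)) (allPaths L)) + length (accepted (λ p → f (down ∷ p)) (allPaths L))
    ≡⟨ cong₂ _+_ (length-accepted-allPaths L _) (length-accepted-allPaths L _) ⟩
  count (suc L) f ∎
  where open ≡-Reasoning

hasCount-count : ∀ L (f : Path L → Bool) {P : Path L → Set} → (∀ p → (f p ≡ true) ⇔ P p) → HasCount P (count L f)
hasCount-count L f {P} spec =
  accepted f (allPaths L) , Unique.filter⁺ _ (allPaths-unique L) , membership , length-accepted-allPaths L f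
  where
  membership : ∀ p → (p ∈ accepted f (allPaths L)) ⇔ P p
  membership p = mk⇔ (λ p∈ → Equivalence.to (spec p) (proj₂ (∈-filter⁻ _ {xs = allPaths L} p∈)))
                     (λ Pp → ∈-filter⁺ _ (∈-allPaths p) (Equivalence.from (spec p) Pp))

downs : ∀ {l} → Path l → ℕ
downs []         = 0
downs (up ∷ p)   = downs p
downs (down ∷ p) = suc (downs p)

ups+downs : ∀ {l} (p : Path l) → ups p + downs p ≡ l
ups+downs []         = refl
ups+downs (up ∷ p)   = cong suc (ups+downs p)
ups+downs (down ∷ p) = trans (+-suc (ups p) (downs p)) (cong suc (ups+downs p))

height≡ups⊖downs : ∀ {l} (p : Path l) → height p ≡ ups p ⊖ downs p
height≡ups⊖downs []         = refl
height≡ups⊖downs (up ∷ p)   =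
  trans (cong (ℤ._+_ ℤ.1ℤ) (height≡ups⊖downs p)) (ℤ.distribʳ-⊖-+-pos 1 (ups p) (downs p))
height≡ups⊖downs (down ∷ p) =
  trans (cong (ℤ._+_ ℤ.-1ℤ) (height≡ups⊖downs p)) (ℤ.distribʳ-⊖-+-neg 0 (ups p) (downs p))

⊖≡0⇒≡ : ∀ m n → m ⊖ n ≡ 0ℤ → m ≡ n
⊖≡0⇒≡ m n m⊖n≡0 = ℤ.+-injective (ℤ.i-j≡0⇒i≡j (ℤ.+ m) (ℤ.+ n) (trans (ℤ.m-n≡m⊖n m n) m⊖n≡0))

balanced⇔height≡0 : ∀ m (p : Path (2 * m)) → Balanced m p ⇔ (height p ≡ 0ℤ)
balanced⇔height≡0 m p = mk⇔
  (λ balanced → trans (height≡ups⊖downs p) (trans (cong₂ _⊖_ balanced (downs≡ balanced)) (ℤ.n⊖n≡0 m)))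
  (λ flat → *-cancelˡ-≡ (ups p) m 2 (trans (cong (ups p +_) (trans (+-identityʳ _) (ups≡downs flat))) (ups+downs p)))
  where
  downs≡ : ups p ≡ m → downs p ≡ m
  downs≡ balanced = +-cancelˡ-≡ m (downs p) m
    (trans (cong (_+ downs p) (sym balanced)) (trans (ups+downs p) (cong (m +_) (+-identityʳ m))))
  ups≡downs : height p ≡ 0ℤ → ups p ≡ downs p
  ups≡downs flat = ⊖≡0⇒≡ (ups p) (downs p) (trans (sym (height≡ups⊖downs p)) flat)

evenZeroed⇔zeroesOnPhase0 : ∀ {l} (p : Path l) → EvenZeroed p ⇔ ZeroesOnPhase0 0ℤ ph0 p
evenZeroed⇔zeroesOnPhase0 p = mk⇔
  (λ evenZeroed k k<l atZero →
    4∣⇒phase≡ph0 (suc k) (evenZeroed (suc k) k<l (trans (sym (ℤ.+-identityˡ _)) atZero)))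
  (λ { zeroes zero    _   _      → 4 ∣0
     ; zeroes (suc k) k<l atZero → phase≡ph0⇒4∣ (suc k) (zeroes k k<l (trans (ℤ.+-identityˡ _) atZero)) })

accepts⇔balanced×evenZeroed : ∀ m (p : Path (2 * m)) →
  (accepts 0ℤ ph0 p ≡ true) ⇔ (Balanced m p × EvenZeroed p)
accepts⇔balanced×evenZeroed m p = mk⇔
  (λ ok → let ends , zeroes = accepts-sound 0ℤ ph0 p ok in
    Equivalence.from (balanced⇔height≡0 m p) (trans (sym (ℤ.+-identityˡ _)) ends) ,
    Equivalence.from (evenZeroed⇔zeroesOnPhase0 p) zeroes)
  (λ (balanced , evenZeroed) → accepts-complete 0ℤ ph0 p
    (trans (ℤ.+-identityˡ _) (Equivalence.to (balanced⇔height≡0 m p) balanced))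
    (Equivalence.to (evenZeroed⇔zeroesOnPhase0 p) evenZeroed))

lemma3 : (n : ℕ) →
    HasCount (λ (p : Path (2 * (2 * n))) → Balanced (2 * n) p × EvenZeroed p) (Catalan (2 * n))
lemma3 n = subst (HasCount _) count≡catalan
  (hasCount-count L (accepts 0ℤ ph0) (accepts⇔balanced×evenZeroed (2 * n)))
  where
  L = 2 * (2 * n)
  4∣L : 4 ∣ L
  4∣L = divides n (trans (sym (*-assoc 2 2 n)) (*-comm 4 n))
  count≡catalan : count L (accepts 0ℤ ph0) ≡ Catalan (2 * n)
  count≡catalan = trans (completions-fromZero L (4∣⇒phase≡ph0 L 4∣L)) (sym (catalan≡firstPassage (2 * n)))
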